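{- For every $n\ge 1$ and every permutation $\pi\in\mathcal{S}_n$: $\pi\in res_n(\tilde{\mathcal{A}})$ if and only if $\pi=\psi(t)$ for some binary increasing tree $t$ with $n$ nodes. More precisely: (i) if $\pi=\psi(t)$ for a binary increasing tree $t$ with $n$ nodes, then $\pi\in res_n(\tilde{\mathcal{A}})$; (ii) if $\pi\in res_n(\tilde{\mathcal{A}})$, then $\pi=\psi(t)$ for some binary increasing tree $t$ with $n$ nodes.
   Context: A binary increasing tree with $n$ nodes is a rooted tree (children unordered) in which every node has $0$, $1$ or $2$ children, whose nodes are labelled bijectively by $\{1,\dots,n\}$ so that labels strictly increase along every path from the root to a leaf. It is strictly binary if no node has exactly one child. The standard drawing of such a tree is the plane tree in which a node with two children has the child of smaller label on its left and the child of larger label on its right, and a node with exactly one child has that child on its right. The left-oriented drawing is the same except that a node with exactly one child has that child on its left. For a binary increasing tree $t$, $\phi(t)$ denotes the permutation obtained by reading the labels of the standard drawing of $t$ in in-order (recursively: left subtree, node, right subtree), and $\psi(t)$ denotes the permutation obtained by reading the labels of the left-oriented drawing of $t$ in in-order. Let $\tilde{\mathcal{A}}$ be the set of all permutations $\phi(t)$ with $t$ a strictly binary increasing tree (of any size); these are the André permutations of the second kind associated with strictly binary increasing trees. For $\pi\in\mathcal{S}_N$ and $1\le k\le N$, the restriction of $\pi$ to $\{1,\dots,k\}$ is the permutation of $\{1,\dots,k\}$ obtained from the word $\pi_1\cdots\pi_N$ by deleting all entries larger than $k$; write $\sigma\lhd\pi$ if $\sigma$ is such a restriction. Define $res_n(\tilde{\mathcal{A}})=\{\sigma\in\mathcal{S}_n:\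 \exists\,\pi\in\tilde{\mathcal{A}},\ \sigma\lhd\pi\}$. -}

module Defs where

open import Data.Nat using (ℕ; zero; suc; _≤_; _<_; _<ᵇ_; _≤?_)
open import Data.Bool using (if_then_else_)
open import Data.List using (List; []; _∷_; _++_; [_]; map; upTo; filter)
open import Data.List.Relation.Binary.Permutation.Propositional using (_↭_)
open import Data.Product using (Σ; ∃; _×_)
open import Relation.Binary.PropositionalEquality using (_≡_)

-- The two children of a binary node are UNORDERED: the order in which they
-- are stored in `node2` is irrelevant, since both drawings below place the
-- child with the smaller root label on the left.
data Tree : Set where
  node0 : ℕ → Tree
  node1 : ℕ → Tree → Tree
  node2 : ℕ → Tree → Tree → Tree

root : Tree → ℕ
root (node0 a)     = a
root (node1 a _)   = a
root (node2 a _ _) = a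

labels : Tree → List ℕ
labels (node0 a)     = [ a ]
labels (node1 a c)   = a ∷ labels c
labels (node2 a l r) = a ∷ (labels l ++ labels r)

data Increasing : Tree → Set where
  inc0 : ∀ {a} → Increasing (node0 a)
  inc1 : ∀ {a c} → a < root c → Increasing c → Increasing (node1 a c)
  inc2 : ∀ {a l r} → a < root l → a < root r →
         Increasing l → Increasing r → Increasing (node2 a l r)

data StrictlyBinary : Tree → Set where
  sb0 : ∀ {a} → StrictlyBinary (node0 a)
  sb2 : ∀ {a l r} → StrictlyBinary l → StrictlyBinary r →
        StrictlyBinary (node2 a l r)

range : ℕ → List ℕ
range n = map suc (upTo n)

IsPerm : ℕ → List ℕ → Set
IsPerm n π = π ↭ range n

BIT : ℕ → Tree → Set
BIT n t = Increasing t × (labels t ↭ range n)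

SBIT : ℕ → Tree → Set
SBIT n t = StrictlyBinary t × BIT n t

-- in-order reading of the standard drawing
φ : Tree → List ℕ
φ (node0 a)     = [ a ]
φ (node1 a c)   = a ∷ φ c
φ (node2 a l r) =
  if root l <ᵇ root r then φ l ++ (a ∷ φ r) else φ r ++ (a ∷ φ l)

-- in-order reading of the left-oriented drawing
ψ : Tree → List ℕ
ψ (node0 a)     = [ a ]
ψ (node1 a c)   = ψ c ++ [ a ]
ψ (node2 a l r) =
  if root l <ᵇ root r then ψ l ++ (a ∷ ψ r) else ψ r ++ (a ∷ ψ l)

-- the set Ã of André permutations of the second kind
InÃ : List ℕ → Set
InÃ π = ∃ λ N → Σ Tree λ t → SBIT N t × φ t ≡ π

restrict : ℕ → List ℕ → List ℕ
restrict k π = filter (λ x → x ≤? k) π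

_◁_ : List ℕ → List ℕ → Set
σ ◁ π = ∃ λ N → ∃ λ k → IsPerm N π × 1 ≤ k × k ≤ N × σ ≡ restrict k π

InRes : ℕ → List ℕ → Set
InRes n σ = IsPerm n σ × (∃ λ π → InÃ π × σ ◁ π)

-- (ii) For a strictly binary increasing tree T, the nodes with label ≤ k form a
-- subtree containing the root. Restricting φ T to {1..k} reads this subtree in
-- order, and a node that keeps only one child keeps the child of smaller label,
-- which the standard drawing put on the left: the restriction is ψ of the
-- pruned subtree. (i) Conversely, give every unary node of a binary increasing
-- tree t with n nodes an extra leaf with a fresh label > n. That leaf exceeds
-- the old child, so φ draws it on the right, and deleting the fresh labels from
-- φ of the completed tree leaves ψ t.
module Submission where

open import Defs
open import Algebra.Bundles using (CommutativeMonoid)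
open import Data.Bool using (Bool; true; false; if_then_else_)
open import Data.Bool.Properties using (T-≡)
open import Data.Empty using (⊥-elim)
open import Data.List using (List; []; _∷_; _++_; [_]; applyUpTo)
open import Data.List.Properties using (filter-accept; filter-++; filter-none; map-upTo; ++-assoc)
open import Data.List.Relation.Unary.All as All using (All; []; _∷_)
import Data.List.Relation.Unary.All.Properties as Allₚ
open import Data.List.Relation.Binary.Permutation.Propositional
  using (_↭_; prep; ↭-refl; ↭-sym; ↭-trans; ↭-reflexive; module PermutationReasoning)
open import Data.List.Relation.Binary.Permutation.Propositional.Properties
  using (shift; ++⁺; ++⁺ʳ; ++-comm; ∷↭∷ʳ; All-resp-↭; ↭-empty-inv; ++-commutativeMonoid)
open import Data.Nat using (ℕ; zero; suc; _+_; _≤_; _<_; _<ᵇ_; _≤?_; s≤s)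
open import Data.Nat.Properties
  using (≤-refl; <⇒≤; <⇒≱; ≰⇒>; ≤-<-trans; <-≤-trans; m≤m+n; +-identityʳ; +-suc; <⇒<ᵇ)
open import Algebra.Properties.CommutativeSemigroup
  (CommutativeMonoid.commutativeSemigroup (++-commutativeMonoid {A = ℕ})) using (interchange)
open import Data.Product using (Σ; ∃; _×_; _,_)
open import Function using (_∘_; Equivalence)
open import Relation.Nullary using (¬_; yes; no)
open import Relation.Binary.PropositionalEquality
  using (_≡_; refl; sym; trans; cong; cong₂; subst; module ≡-Reasoning)

<⇒<ᵇ≡true : ∀ {m n} → m < n → (m <ᵇ n) ≡ true
<⇒<ᵇ≡true m<n = Equivalence.to T-≡ (<⇒<ᵇ m<n)

≤⇒>ᵇ≡false : ∀ {m n} → n ≤ m → (m <ᵇ n) ≡ false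
≤⇒>ᵇ≡false {m}     {zero}  _         = refl
≤⇒>ᵇ≡false {suc m} {suc n} (s≤s n≤m) = ≤⇒>ᵇ≡false n≤m

restrict-∷-≤ : ∀ {k x} xs → x ≤ k → restrict k (x ∷ xs) ≡ x ∷ restrict k xs
restrict-∷-≤ {k} xs = filter-accept (_≤? k)

restrict-++-∷ : ∀ {k x} xs ys → x ≤ k →
                restrict k (xs ++ x ∷ ys) ≡ restrict k xs ++ x ∷ restrict k ys
restrict-++-∷ {k} xs ys x≤k =
  trans (filter-++ (_≤? k) xs _) (cong (restrict k xs ++_) (restrict-∷-≤ ys x≤k))

restrict-all> : ∀ {k xs} → All (k <_) xs → restrict k xs ≡ []
restrict-all> {k} k<xs = filter-none (_≤? k) (All.map <⇒≱ k<xs)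

-- Both drawings read a node a with two children this way, where b tells whether
-- the child read as xs has the smaller root.
inorder₂ : Bool → List ℕ → ℕ → List ℕ → List ℕ
inorder₂ b xs a ys = if b then xs ++ a ∷ ys else ys ++ a ∷ xs

restrict-inorder₂ : ∀ {k a} b xs ys → a ≤ k →
  restrict k (inorder₂ b xs a ys) ≡ inorder₂ b (restrict k xs) a (restrict k ys)
restrict-inorder₂ true  xs ys = restrict-++-∷ xs ys
restrict-inorder₂ false xs ys = restrict-++-∷ ys xs

inorder₂-true : ∀ {b} xs a ys → b ≡ true → inorder₂ b xs a ys ≡ xs ++ a ∷ ys
inorder₂-true xs a ys refl = refl

inorder₂-false : ∀ {b} xs a ys → b ≡ false → inorder₂ b xs a ys ≡ ys ++ a ∷ xs
inorder₂-false xs a ys refl = refl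

inorder₂-[] : ∀ b a → inorder₂ b [] a [] ≡ [ a ]
inorder₂-[] true  a = refl
inorder₂-[] false a = refl

inorder₂-↭ : ∀ b xs a ys → inorder₂ b xs a ys ↭ a ∷ xs ++ ys
inorder₂-↭ true  xs a ys = shift a xs ys
inorder₂-↭ false xs a ys = ↭-trans (shift a ys xs) (prep a (++-comm ys xs))

labels↭inorder₂ : ∀ {a b l r xs ys} → labels l ↭ xs → labels r ↭ ys →
                  labels (node2 a l r) ↭ inorder₂ b xs a ys
labels↭inorder₂ {a} {b} {xs = xs} {ys} l↭xs r↭ys =
  ↭-trans (prep a (++⁺ l↭xs r↭ys)) (↭-sym (inorder₂-↭ b xs a ys))

labels↭φ : ∀ t → labels t ↭ φ t
labels↭φ (node0 a)     = ↭-refl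
labels↭φ (node1 a c)   = prep a (labels↭φ c)
labels↭φ (node2 a l r) = labels↭inorder₂ (labels↭φ l) (labels↭φ r)

labels↭ψ : ∀ t → labels t ↭ ψ t
labels↭ψ (node0 a)     = ↭-refl
labels↭ψ (node1 a c)   = ↭-trans (prep a (labels↭ψ c)) (∷↭∷ʳ a (ψ c))
labels↭ψ (node2 a l r) = labels↭inorder₂ (labels↭ψ l) (labels↭ψ r)

All-labels⇒root : ∀ {P : ℕ → Set} t → All P (labels t) → P (root t)
All-labels⇒root (node0 a)     (pa ∷ _) = pa
All-labels⇒root (node1 a _)   (pa ∷ _) = pa
All-labels⇒root (node2 a _ _) (pa ∷ _) = pa

root≤labels : ∀ {t} → Increasing t → All (root t ≤_) (labels t)
root≤labels inc0 = ≤-refl ∷ []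
root≤labels (inc1 a<c ic) = ≤-refl ∷ All.map (<⇒≤ ∘ <-≤-trans a<c) (root≤labels ic)
root≤labels (inc2 a<l a<r il ir) =
  ≤-refl ∷ Allₚ.++⁺ (All.map (<⇒≤ ∘ <-≤-trans a<l) (root≤labels il))
                   (All.map (<⇒≤ ∘ <-≤-trans a<r) (root≤labels ir))

restrict-φ-below-root : ∀ {k t} → Increasing t → k < root t → restrict k (φ t) ≡ []
restrict-φ-below-root {t = t} it k<root =
  restrict-all> (All-resp-↭ (labels↭φ t) (All.map (<-≤-trans k<root) (root≤labels it)))

data Pruning (k : ℕ) (T : Tree) : Set where
  vanishes : k < root T → restrict k (φ T) ≡ [] → Pruning k T
  survives : (t : Tree) → Increasing t → root t ≡ root T → root T ≤ k →
             ψ t ≡ restrict k (φ T) → Pruning k T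

prune : ∀ k T → StrictlyBinary T → Increasing T → Pruning k T
prune k T sb it with root T ≤? k
... | no T≰k = vanishes (≰⇒> T≰k) (restrict-φ-below-root it (≰⇒> T≰k))
prune k (node0 a) sb0 inc0 | yes a≤k =
  survives (node0 a) inc0 refl a≤k (sym (restrict-∷-≤ [] a≤k))
prune k (node2 a l r) (sb2 sl sr) (inc2 a<l a<r il ir) | yes a≤k
  with prune k l sl il | prune k r sr ir
... | vanishes _ l-empty | vanishes _ r-empty =
  survives (node0 a) inc0 refl a≤k (sym (begin
    restrict k (φ (node2 a l r))                        ≡⟨ restrict-inorder₂ b (φ l) (φ r) a≤k ⟩
    inorder₂ b (restrict k (φ l)) a (restrict k (φ r))  ≡⟨ cong₂ (λ xs ys → inorder₂ b xs a ys) l-empty r-empty ⟩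
    inorder₂ b [] a []                                  ≡⟨ inorder₂-[] b a ⟩
    [ a ]                                               ∎))
  where
  b = root l <ᵇ root r
  open ≡-Reasoning
... | survives l′ il′ l′-root l≤k ψl′ | vanishes k<r r-empty =
  survives (node1 a l′) (inc1 (subst (a <_) (sym l′-root) a<l) il′) refl a≤k (sym (begin
    restrict k (φ (node2 a l r))                        ≡⟨ restrict-inorder₂ b (φ l) (φ r) a≤k ⟩
    inorder₂ b (restrict k (φ l)) a (restrict k (φ r))  ≡⟨ inorder₂-true _ a _ (<⇒<ᵇ≡true (≤-<-trans l≤k k<r)) ⟩
    restrict k (φ l) ++ a ∷ restrict k (φ r)            ≡⟨ cong₂ (λ xs ys → xs ++ a ∷ ys) (sym ψl′) r-empty ⟩
    ψ l′ ++ [ a ]                                       ∎))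
  where
  b = root l <ᵇ root r
  open ≡-Reasoning
... | vanishes k<l l-empty | survives r′ ir′ r′-root r≤k ψr′ =
  survives (node1 a r′) (inc1 (subst (a <_) (sym r′-root) a<r) ir′) refl a≤k (sym (begin
    restrict k (φ (node2 a l r))                        ≡⟨ restrict-inorder₂ b (φ l) (φ r) a≤k ⟩
    inorder₂ b (restrict k (φ l)) a (restrict k (φ r))  ≡⟨ inorder₂-false _ a _ (≤⇒>ᵇ≡false (<⇒≤ (≤-<-trans r≤k k<l))) ⟩
    restrict k (φ r) ++ a ∷ restrict k (φ l)            ≡⟨ cong₂ (λ xs ys → xs ++ a ∷ ys) (sym ψr′) l-empty ⟩
    ψ r′ ++ [ a ]                                       ∎))
  where
  b = root l <ᵇ root r
  open ≡-Reasoning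
... | survives l′ il′ l′-root _ ψl′ | survives r′ ir′ r′-root _ ψr′ =
  survives (node2 a l′ r′)
           (inc2 (subst (a <_) (sym l′-root) a<l) (subst (a <_) (sym r′-root) a<r) il′ ir′)
           refl a≤k (sym (begin
    restrict k (φ (node2 a l r))                        ≡⟨ restrict-inorder₂ b (φ l) (φ r) a≤k ⟩
    inorder₂ b (restrict k (φ l)) a (restrict k (φ r))  ≡⟨ cong₂ (λ xs ys → inorder₂ b xs a ys) (sym ψl′) (sym ψr′) ⟩
    inorder₂ b (ψ l′) a (ψ r′)                          ≡⟨ cong₂ (λ u v → inorder₂ (u <ᵇ v) (ψ l′) a (ψ r′)) (sym l′-root) (sym r′-root) ⟩
    ψ (node2 a l′ r′)                                   ∎))
  where
  b = root l <ᵇ root r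
  open ≡-Reasoning

interval : ℕ → ℕ → List ℕ
interval c zero    = []
interval c (suc m) = c ∷ interval (suc c) m

interval-++ : ∀ c m m′ → interval c m ++ interval (c + m) m′ ≡ interval c (m + m′)
interval-++ c zero     m′ = cong (λ c′ → interval c′ m′) (+-identityʳ c)
interval-++ c (suc m) m′ =
  cong (c ∷_) (trans (cong (λ c′ → interval (suc c) m ++ interval c′ m′) (+-suc c m))
                     (interval-++ (suc c) m m′))

applyUpTo≡interval : ∀ f c n → (∀ i → f i ≡ c + i) → applyUpTo f n ≡ interval c n
applyUpTo≡interval f c zero    f≗c+ = refl
applyUpTo≡interval f c (suc n) f≗c+ =
  cong₂ _∷_ (trans (f≗c+ 0) (+-identityʳ c))
            (applyUpTo≡interval (f ∘ suc) (suc c) n (λ i → trans (f≗c+ (suc i)) (+-suc c i)))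

range-+ : ∀ n m → range (n + m) ≡ range n ++ interval (suc n) m
range-+ n m = begin
  range (n + m)                       ≡⟨ range≡interval (n + m) ⟩
  interval 1 (n + m)                  ≡⟨ interval-++ 1 n m ⟨
  interval 1 n ++ interval (suc n) m  ≡⟨ cong (_++ interval (suc n) m) (range≡interval n) ⟨
  range n ++ interval (suc n) m       ∎
  where
  range≡interval : ∀ n → range n ≡ interval 1 n
  range≡interval n = trans (map-upTo suc n) (applyUpTo≡interval suc 1 n (λ _ → refl))
  open ≡-Reasoning

range-bounded : ∀ n → All (_≤ n) (range n)
range-bounded n = Allₚ.map⁺ (Allₚ.applyUpTo⁺₁ (λ i → i) n (λ i<n → i<n))

¬IsPerm-[] : ∀ {n} → 1 ≤ n → ¬ IsPerm n []
¬IsPerm-[] {suc n} _ p with () ← ↭-empty-inv (↭-sym p)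

#unary : Tree → ℕ
#unary (node0 a)     = 0
#unary (node1 a x)   = #unary x + 1
#unary (node2 a l r) = #unary l + #unary r

-- Fresh leaves are labelled c, c+1, ... in post-order of their unary parents.
complete : ℕ → Tree → Tree
complete c (node0 a)     = node0 a
complete c (node1 a x)   = node2 a (complete c x) (node0 (c + #unary x))
complete c (node2 a l r) = node2 a (complete c l) (complete (c + #unary l) r)

root-complete : ∀ c t → root (complete c t) ≡ root t
root-complete c (node0 a)     = refl
root-complete c (node1 a x)   = refl
root-complete c (node2 a l r) = refl

complete-strictlyBinary : ∀ c t → StrictlyBinary (complete c t)
complete-strictlyBinary c (node0 a)     = sb0
complete-strictlyBinary c (node1 a x)   = sb2 (complete-strictlyBinary c x) sb0
complete-strictlyBinary c (node2 a l r) =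
  sb2 (complete-strictlyBinary c l) (complete-strictlyBinary (c + #unary l) r)

labels-complete : ∀ c t → labels (complete c t) ↭ labels t ++ interval c (#unary t)
labels-complete c (node0 a)     = ↭-refl
labels-complete c (node1 a x)   = prep a (begin
  labels (complete c x) ++ [ c + #unary x ]
      ↭⟨ ++⁺ʳ _ (labels-complete c x) ⟩
  (labels x ++ interval c (#unary x)) ++ interval (c + #unary x) 1
      ≡⟨ ++-assoc (labels x) _ _ ⟩
  labels x ++ interval c (#unary x) ++ interval (c + #unary x) 1
      ≡⟨ cong (labels x ++_) (interval-++ c (#unary x) 1) ⟩
  labels x ++ interval c (#unary x + 1) ∎)
  where open PermutationReasoning
labels-complete c (node2 a l r) = prep a (begin
  labels (complete c l) ++ labels (complete c′ r)
      ↭⟨ ++⁺ (labels-complete c l) (labels-complete c′ r) ⟩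
  (labels l ++ interval c (#unary l)) ++ (labels r ++ interval c′ (#unary r))
      ↭⟨ interchange (labels l) _ (labels r) _ ⟩
  (labels l ++ labels r) ++ (interval c (#unary l) ++ interval c′ (#unary r))
      ≡⟨ cong ((labels l ++ labels r) ++_) (interval-++ c (#unary l) (#unary r)) ⟩
  (labels l ++ labels r) ++ interval c (#unary l + #unary r) ∎)
  where
  open PermutationReasoning
  c′ = c + #unary l

complete-increasing : ∀ {n} c t → Increasing t → All (_≤ n) (labels t) → n < c →
                      Increasing (complete c t)
complete-increasing c (node0 a) inc0 _ _ = inc0
complete-increasing c (node1 a x) (inc1 a<x ix) (a≤n ∷ x≤n) n<c =
  inc2 (subst (a <_) (sym (root-complete c x)) a<x)
       (≤-<-trans a≤n (<-≤-trans n<c (m≤m+n c (#unary x))))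
       (complete-increasing c x ix x≤n n<c) inc0
complete-increasing c (node2 a l r) (inc2 a<l a<r il ir) (a≤n ∷ lr≤n) n<c =
  inc2 (subst (a <_) (sym (root-complete c l)) a<l)
       (subst (a <_) (sym (root-complete (c + #unary l) r)) a<r)
       (complete-increasing c l il (Allₚ.++⁻ˡ (labels l) lr≤n) n<c)
       (complete-increasing (c + #unary l) r ir (Allₚ.++⁻ʳ (labels l) lr≤n)
                            (<-≤-trans n<c (m≤m+n c (#unary l))))

restrict-φ-complete : ∀ {n} c t → All (_≤ n) (labels t) → n < c →
                      restrict n (φ (complete c t)) ≡ ψ t
restrict-φ-complete c (node0 a) (a≤n ∷ []) _ = restrict-∷-≤ [] a≤n
restrict-φ-complete {n} c (node1 a x) (a≤n ∷ x≤n) n<c = begin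
  restrict n (inorder₂ (root (complete c x) <ᵇ m) (φ (complete c x)) a [ m ])
      ≡⟨ cong (restrict n) (inorder₂-true _ a _ (<⇒<ᵇ≡true x<m)) ⟩
  restrict n (φ (complete c x) ++ a ∷ [ m ])
      ≡⟨ restrict-++-∷ (φ (complete c x)) [ m ] a≤n ⟩
  restrict n (φ (complete c x)) ++ a ∷ restrict n [ m ]
      ≡⟨ cong₂ (λ xs ys → xs ++ a ∷ ys) (restrict-φ-complete c x x≤n n<c) (restrict-all> (n<m ∷ [])) ⟩
  ψ x ++ [ a ] ∎
  where
  open ≡-Reasoning
  m : ℕ
  m = c + #unary x
  n<m : n < m
  n<m = <-≤-trans n<c (m≤m+n c (#unary x))
  x<m : root (complete c x) < m
  x<m = subst (_< m) (sym (root-complete c x)) (≤-<-trans (All-labels⇒root x x≤n) n<m)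
restrict-φ-complete {n} c (node2 a l r) (a≤n ∷ lr≤n) n<c = begin
  restrict n (inorder₂ b (φ (complete c l)) a (φ (complete c′ r)))
      ≡⟨ restrict-inorder₂ b _ _ a≤n ⟩
  inorder₂ b (restrict n (φ (complete c l))) a (restrict n (φ (complete c′ r)))
      ≡⟨ cong₂ (λ xs ys → inorder₂ b xs a ys)
               (restrict-φ-complete c l (Allₚ.++⁻ˡ (labels l) lr≤n) n<c)
               (restrict-φ-complete c′ r (Allₚ.++⁻ʳ (labels l) lr≤n) (<-≤-trans n<c (m≤m+n c (#unary l)))) ⟩
  inorder₂ b (ψ l) a (ψ r)
      ≡⟨ cong₂ (λ u v → inorder₂ (u <ᵇ v) (ψ l) a (ψ r)) (root-complete c l) (root-complete c′ r) ⟩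
  ψ (node2 a l r) ∎
  where
  c′ = c + #unary l
  b = root (complete c l) <ᵇ root (complete c′ r)
  open ≡-Reasoning

ψ-◁-André : ∀ {n t} → 1 ≤ n → BIT n t → ∃ λ ρ → InÃ ρ × ψ t ◁ ρ
ψ-◁-André {n} {t} 1≤n (it , t-labels) =
  φ T , (N , T , (complete-strictlyBinary c t , T-increasing , T-labels) , refl)
      , (N , n , ↭-trans (↭-sym (labels↭φ T)) T-labels , 1≤n , m≤m+n n (#unary t)
        , sym (restrict-φ-complete c t t≤n ≤-refl))
  where
  c = suc n
  T = complete c t
  N = n + #unary t
  t≤n : All (_≤ n) (labels t)
  t≤n = All-resp-↭ (↭-sym t-labels) (range-bounded n)
  T-increasing : Increasing T
  T-increasing = complete-increasing c t it t≤n ≤-refl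
  T-labels : labels T ↭ range N
  T-labels = ↭-trans (labels-complete c t)
               (↭-trans (++⁺ʳ _ t-labels) (↭-reflexive (sym (range-+ n (#unary t)))))

◁-André⇒ψ : ∀ {n σ ρ} → 1 ≤ n → IsPerm n σ → InÃ ρ → σ ◁ ρ →
            Σ Tree λ t → BIT n t × ψ t ≡ σ
◁-André⇒ψ {n} 1≤n σ-perm (_ , T , (sb , it , _) , refl) (_ , k , _ , _ , _ , refl)
  with prune k T sb it
... | vanishes _ σ≡[] = ⊥-elim (¬IsPerm-[] 1≤n (subst (IsPerm n) σ≡[] σ-perm))
... | survives t it′ _ _ ψt≡σ =
  t , (it′ , ↭-trans (labels↭ψ t) (subst (_↭ range n) (sym ψt≡σ) σ-perm)) , ψt≡σ

proposition1 : (n : ℕ) → 1 ≤ n → (π : List ℕ) → IsPerm n π →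
    ((Σ Tree λ t → BIT n t × ψ t ≡ π) → InRes n π)
    × (InRes n π → Σ Tree λ t → BIT n t × ψ t ≡ π)
proposition1 n 1≤n π π-perm =
    (λ { (t , bit , refl) → π-perm , ψ-◁-André 1≤n bit })
  , (λ { (_ , ρ , ρ∈Ã , π◁ρ) → ◁-André⇒ψ 1≤n π-perm ρ∈Ã π◁ρ })
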